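{- Let $2 \leq \ell \leq k \leq \frac{q^n-1}{q-1}$ with $\ell \leq n$. Then $$\left\lceil\frac{1}{q-1}\operatorname{Ind}_q(n,k,\ell)\right\rceil\leq \operatorname{Ind}_q^{\operatorname{pro}}(n,k,\ell)\leq \left\lfloor\frac{1}{q-1}\operatorname{Ind}_q(n,(q-1)k,\ell)\right\rfloor.$$
   Context: For $1\le\ell\le k\le q^n-1$ with $\ell\le n$, $S\subseteq\mathbb{F}_q^n\setminus\{\mathbf 0\}$ is $(k,\ell)$-independent if every subset of $S$ of size $k$ contains $\ell$ linearly independent vectors, and $\operatorname{Ind}_q(n,k,\ell)$ is the maximum size of such $S$. For $1\le\ell\le k\le\frac{q^n-1}{q-1}$ with $\ell\le n$, $S\subseteq\mathbb{P}^{n-1}(\mathbb{F}_q)$ is $(k,\ell)$-pro-independent if every $X\subseteq S$ of size $k$ contains $\ell$ linearly independent points, and $\operatorname{Ind}^{\rm pro}_q(n,k,\ell)$ is the maximum size of such $S$. -}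

module Defs where

open import Level using (0ℓ)
open import Data.Nat using (ℕ; zero; suc; _≤_; _∸_; NonZero) renaming (_+_ to _+ℕ_)
open import Data.Nat.DivMod using (_/_)
open import Data.Fin using (Fin; zero; suc)
open import Data.List using (List; []; _∷_; length)
open import Data.List.Relation.Unary.All using (All)
open import Data.List.Relation.Unary.AllPairs using (AllPairs)
open import Data.List.Relation.Binary.Sublist.Propositional using (_⊆_)
open import Data.Product using (Σ; ∃; _×_)
open import Relation.Nullary using (¬_)
open import Relation.Binary.PropositionalEquality using (_≡_; _≢_)
open import Algebra.Structures using (IsCommutativeRing)
open import Function.Bundles using (_↔_)

record FiniteField (q : ℕ) : Set₁ where
  infixl 7 _*_
  infixl 6 _+_
  field
    F    : Set
    _+_  : F → F → F
    _*_  : F → F → F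
    -_   : F → F
    0#   : F
    1#   : F
    isCommutativeRing : IsCommutativeRing _≡_ _+_ _*_ -_ 0# 1#
    0≢1      : 0# ≢ 1#
    inverse  : (x : F) → x ≢ 0# → Σ F (λ y → x * y ≡ 1#)
    enumerate : Fin q ↔ F

⌈_/_⌉ : ℕ → (d : ℕ) → .{{NonZero d}} → ℕ
⌈ a / d ⌉ = (a +ℕ (d ∸ 1)) / d

module _ {q : ℕ} (𝔽 : FiniteField q) where
  open FiniteField 𝔽

  Vect : ℕ → Set
  Vect n = Fin n → F

  IsZero : {n : ℕ} → Vect n → Set
  IsZero v = ∀ j → v j ≡ 0#

  SameVec : {n : ℕ} → Vect n → Vect n → Set
  SameVec u v = ∀ j → u j ≡ v j

  -- u is a scalar multiple of v (same projective point, for nonzero u v)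
  Proportional : {n : ℕ} → Vect n → Vect n → Set
  Proportional u v = Σ F (λ a → ∀ j → u j ≡ a * v j)

  lincomb : {n : ℕ} (xs : List (Vect n)) → (Fin (length xs) → F) → Vect n
  lincomb []       c j = 0#
  lincomb (x ∷ xs) c j = c zero * x j + lincomb xs (λ i → c (suc i)) j

  LinIndep : {n : ℕ} → List (Vect n) → Set
  LinIndep xs = ∀ c → IsZero (lincomb xs c) → ∀ i → c i ≡ 0#

  KLProperty : {n : ℕ} → ℕ → ℕ → List (Vect n) → Set
  KLProperty k ℓ S = ∀ X → X ⊆ S → length X ≡ k →
    ∃ (λ Y → Y ⊆ X × length Y ≡ ℓ × LinIndep Y)

  -- S ⊆ 𝔽_q^n ∖ {0} (a finite set, listed without repetition) is (k,ℓ)-independent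
  IndSet : (n k ℓ : ℕ) → List (Vect n) → Set
  IndSet n k ℓ S = All (λ v → ¬ IsZero v) S
                 × AllPairs (λ u v → ¬ SameVec u v) S
                 × KLProperty k ℓ S

  -- S ⊆ P^{n-1}(𝔽_q), each point given by a nonzero representative vector,
  -- distinct points = non-proportional representatives; (k,ℓ)-pro-independent
  ProIndSet : (n k ℓ : ℕ) → List (Vect n) → Set
  ProIndSet n k ℓ S = All (λ v → ¬ IsZero v) S
                    × AllPairs (λ u v → ¬ Proportional u v) S
                    × KLProperty k ℓ S

IsMaxSize : {A : Set} → (List A → Set) → ℕ → Set
IsMaxSize P m = ∃ (λ S → P S × length S ≡ m) × (∀ S → P S → length S ≤ m)

{-# OPTIONS --safe #-}
-- Lower bound: keeping one vector of a (k,ℓ)-independent set S on each line it meets gives a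
-- (k,ℓ)-pro-independent set R, and S has at most q − 1 vectors on each line, so |S| ≤ (q − 1)|R|.
-- Upper bound: the q − 1 nonzero multiples of each point of a (k,ℓ)-pro-independent set T are
-- distinct vectors, and any (q − 1)k of them meet at least k points of T; ℓ independent points
-- among these have ℓ independent representatives in the chosen vectors.

module Submission where

open import Defs
open import Data.Nat using (ℕ; _≤_; _*_; _^_; _∸_; NonZero)
open import Data.Nat.DivMod using (_/_)
open import Data.Product using (_×_)

open import Data.Nat using (zero; suc; _+_; _<_; z≤n; s≤s)
import Data.Nat.Properties as ℕ
open import Data.Nat.DivMod using (m<n*o⇒m/o<n; /-monoˡ-≤; m*n/n≡m)
open import Data.Fin using (Fin; zero; suc; punchIn; punchOut; combine)
open import Data.Fin.Properties
  using (punchIn-punchOut; punchInᵢ≢i; punchIn-injective; combine-injective; ¬∀⟶∃¬)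
  renaming (_≟_ to _≟ᶠ_; any? to anyᶠ?; all? to allᶠ?)
open import Data.List using (List; []; _∷_; length; _++_; take; tabulate; concatMap; lookup)
open import Data.List.Properties using (length-++; length-tabulate; length-take)
open import Data.List.Membership.Propositional using (_∈_)
open import Data.List.Membership.Propositional.Properties using (∈-tabulate⁻)
open import Data.List.Relation.Unary.All as All using (All; []; _∷_)
open import Data.List.Relation.Unary.All.Properties using (¬Any⇒All¬; ++⁺; tabulate⁺)
open import Data.List.Relation.Unary.AllPairs using (AllPairs; []; _∷_)
import Data.List.Relation.Unary.AllPairs.Properties as AllPairs
open import Data.List.Relation.Unary.Any as Any using (Any; here; there)
open import Data.List.Relation.Unary.Any.Properties using (lookup-index)
open import Data.List.Relation.Binary.Pointwise using (Pointwise; []; _∷_; Pointwise-length)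
import Data.List.Relation.Binary.Pointwise as Pointwise
open import Data.List.Relation.Binary.Sublist.Propositional using (_⊆_; []; _∷_; _∷ʳ_; ⊆-trans)
import Data.List.Relation.Binary.Sublist.Propositional as Sublist
open import Data.List.Relation.Binary.Sublist.Propositional.Properties
  using (All-resp-⊆; take-⊆; ++⁺ˡ; length-mono-≤)
open import Data.Product using (Σ; ∃; ∃₂; _,_; proj₁; proj₂)
open import Function using (_∘_)
open import Function.Bundles using (Inverse; Injection)
open import Function.Properties.Inverse using (↔-sym; ↔⇒↣)
open import Algebra.Structures using (IsCommutativeRing)
open import Relation.Nullary using (¬_; Dec; yes; no)
open import Relation.Nullary.Decidable using (via-injection)
open import Relation.Binary.Definitions using (DecidableEquality)
open import Relation.Binary.PropositionalEquality

module _ {A : Set} where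

  ⊆-++⁻ : ∀ xs {ys zs : List A} → zs ⊆ xs ++ ys →
          ∃₂ λ zs₁ zs₂ → zs ≡ zs₁ ++ zs₂ × zs₁ ⊆ xs × zs₂ ⊆ ys
  ⊆-++⁻ []       zs⊆ = [] , _ , refl , [] , zs⊆
  ⊆-++⁻ (x ∷ xs) (.x ∷ʳ zs⊆) with ⊆-++⁻ xs zs⊆
  ... | zs₁ , zs₂ , refl , zs₁⊆ , zs₂⊆ = zs₁ , zs₂ , refl , x ∷ʳ zs₁⊆ , zs₂⊆
  ⊆-++⁻ (x ∷ xs) (refl ∷ zs⊆) with ⊆-++⁻ xs zs⊆
  ... | zs₁ , zs₂ , refl , zs₁⊆ , zs₂⊆ = x ∷ zs₁ , zs₂ , refl , refl ∷ zs₁⊆ , zs₂⊆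

  -- Once x has taken colour i, punching i out recolours the later elements with Fin m.
  pigeonhole : ∀ {D : A → A → Set} m (C : A → Fin m → Set) →
               (∀ {x y i} → C x i → C y i → ¬ D x y) →
               ∀ {xs} → AllPairs D xs → All (λ x → ∃ (C x)) xs → length xs ≤ m
  pigeonhole m       C clash []          []                = z≤n
  pigeonhole zero    C clash (_ ∷ _)     ((() , _) ∷ _)
  pigeonhole {D} (suc m) C clash {x ∷ _} (Dx ∷ Dxs) ((i , Cxi) ∷ colours) =
    s≤s (pigeonhole m (λ y j → C y (punchIn i j)) clash Dxs (recolour Dx colours))
    where
    recolour : ∀ {ys} → All (D x) ys → All (λ y → ∃ (C y)) ys →
               All (λ y → ∃ λ j → C y (punchIn i j)) ys
    recolour []           []                     = []
    recolour (Dxy ∷ Dxys) ((i′ , Cyi′) ∷ colours′) =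
      (punchOut i≢i′ , subst (C _) (sym (punchIn-punchOut i≢i′)) Cyi′) ∷ recolour Dxys colours′
      where
      i≢i′ : i ≢ i′
      i≢i′ refl = clash Cxi Cyi′ Dxy

module _ {A : Set} {P : A → A → Set} (P? : ∀ x y → Dec (P x y)) (P-refl : ∀ {x} → P x x) where

  representatives : (xs : List A) →
    ∃ λ ys → ys ⊆ xs × AllPairs (λ u v → ¬ P u v) ys × All (λ x → Any (P x) ys) xs
  representatives [] = [] , [] , [] , []
  representatives (x ∷ xs) with representatives xs
  ... | ys , ys⊆ , apart , cover with Any.any? (P? x) ys
  ... | yes Pxys = ys , x ∷ʳ ys⊆ , apart , Pxys ∷ cover
  ... | no ¬Pxys =
    x ∷ ys , refl ∷ ys⊆ , ¬Any⇒All¬ ys ¬Pxys ∷ apart , here P-refl ∷ All.map there cover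

module _ {A B : Set} {R : A → B → Set} where

  Pointwise-⊆ʳ : ∀ {xs ys ys′} → Pointwise R xs ys → ys′ ⊆ ys →
                 ∃ λ xs′ → xs′ ⊆ xs × Pointwise R xs′ ys′
  Pointwise-⊆ʳ []           []            = [] , [] , []
  Pointwise-⊆ʳ (_   ∷ Rxsys) (_ ∷ʳ ys′⊆)  with Pointwise-⊆ʳ Rxsys ys′⊆
  ... | xs′ , xs′⊆ , Rxs′ys′ = xs′ , _ ∷ʳ xs′⊆ , Rxs′ys′
  Pointwise-⊆ʳ (Rxy ∷ Rxsys) (refl ∷ ys′⊆) with Pointwise-⊆ʳ Rxsys ys′⊆
  ... | xs′ , xs′⊆ , Rxs′ys′ = _ ∷ xs′ , refl ∷ xs′⊆ , Rxy ∷ Rxs′ys′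

module _ {A B : Set} (G : B → List A) {d : ℕ} (|G|≤d : ∀ t → length (G t) ≤ d) where

  -- xs′ keeps one element of xs from each block G t that xs meets.
  transversal : ∀ ts {xs} → xs ⊆ concatMap G ts →
    ∃₂ λ ts′ xs′ → ts′ ⊆ ts × xs′ ⊆ xs × Pointwise (λ x t → x ∈ G t) xs′ ts′ ×
                   length xs ≤ length ts′ * d
  transversal []       [] = [] , [] , [] , [] , [] , z≤n
  transversal (t ∷ ts) xs⊆ with ⊆-++⁻ (G t) xs⊆
  ... | xs₁ , xs₂ , refl , xs₁⊆ , xs₂⊆ with transversal ts xs₂⊆
  ... | ts′ , xs′ , ts′⊆ , xs′⊆ , xs′∈ , |xs₂|≤ = extend xs₁ xs₁⊆
    where
    extend : ∀ xs₁ → xs₁ ⊆ G t →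
      ∃₂ λ ts″ xs″ → ts″ ⊆ t ∷ ts × xs″ ⊆ xs₁ ++ xs₂ × Pointwise (λ x t → x ∈ G t) xs″ ts″ ×
                     length (xs₁ ++ xs₂) ≤ length ts″ * d
    extend []        _   = ts′ , xs′ , t ∷ʳ ts′⊆ , xs′⊆ , xs′∈ , |xs₂|≤
    extend (x ∷ xs₁) xs₁⊆′ =
      t ∷ ts′ , x ∷ xs′ , refl ∷ ts′⊆ , refl ∷ ++⁺ˡ xs₁ xs′⊆ ,
      Sublist.lookup xs₁⊆′ (here refl) ∷ xs′∈ ,
      subst (_≤ d + length ts′ * d) (sym (length-++ (x ∷ xs₁)))
            (ℕ.+-mono-≤ (ℕ.≤-trans (length-mono-≤ xs₁⊆′) (|G|≤d t)) |xs₂|≤)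

module FieldProperties {q : ℕ} (𝔽 : FiniteField q) where
  open FiniteField 𝔽 using (F; 0#; 1#; inverse; enumerate; isCommutativeRing) renaming (_*_ to _·_)
  open IsCommutativeRing isCommutativeRing
    using (*-assoc; *-comm; *-identityˡ; zeroˡ; zeroʳ; +-cong)
  open Inverse enumerate using (to; from; strictlyInverseˡ)
  open ≡-Reasoning

  _≟_ : DecidableEquality F
  _≟_ = via-injection (↔⇒↣ (↔-sym enumerate)) _≟ᶠ_

  ·-cancelˡ : ∀ {a x y} → a ≢ 0# → a · x ≡ a · y → x ≡ y
  ·-cancelˡ {a} {x} {y} a≢0 ax≡ay = begin
    x             ≡⟨ *-identityˡ x ⟨
    1# · x        ≡⟨ cong (_· x) a⁻¹a≡1 ⟨
    a⁻¹ · a · x   ≡⟨ *-assoc a⁻¹ a x ⟩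
    a⁻¹ · (a · x) ≡⟨ cong (a⁻¹ ·_) ax≡ay ⟩
    a⁻¹ · (a · y) ≡⟨ *-assoc a⁻¹ a y ⟨
    a⁻¹ · a · y   ≡⟨ cong (_· y) a⁻¹a≡1 ⟩
    1# · y        ≡⟨ *-identityˡ y ⟩
    y             ∎
    where
    a⁻¹ : F
    a⁻¹ = proj₁ (inverse a a≢0)
    a⁻¹a≡1 : a⁻¹ · a ≡ 1#
    a⁻¹a≡1 = trans (*-comm a⁻¹ a) (proj₂ (inverse a a≢0))

  ·-cancelʳ : ∀ {a b x} → x ≢ 0# → a · x ≡ b · x → a ≡ b
  ·-cancelʳ {a} {b} {x} x≢0 ax≡bx = ·-cancelˡ x≢0 (trans (*-comm x a) (trans ax≡bx (*-comm b x)))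

  a·x≡0⇒x≡0 : ∀ {a x} → a ≢ 0# → a · x ≡ 0# → x ≡ 0#
  a·x≡0⇒x≡0 {a} a≢0 ax≡0 = ·-cancelˡ a≢0 (trans ax≡0 (sym (zeroʳ a)))

  module _ {n : ℕ} where

    infixr 7 _•_
    _•_ : F → Vect 𝔽 n → Vect 𝔽 n
    (a • v) j = a · v j

    _∼_ : Vect 𝔽 n → Vect 𝔽 n → Set
    u ∼ v = Σ F λ a → a ≢ 0# × SameVec 𝔽 u (a • v)

    nonzero-coordinate : ∀ {v} → ¬ IsZero 𝔽 v → ∃ λ j → v j ≢ 0#
    nonzero-coordinate {v} = ¬∀⟶∃¬ n _ (λ j → v j ≟ 0#)

    proportional? : (u v : Vect 𝔽 n) → Dec (Proportional 𝔽 u v)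
    proportional? u v with anyᶠ? (λ i → allᶠ? (λ j → u j ≟ (to i · v j)))
    ... | yes (i , u≡iv) = yes (to i , u≡iv)
    ... | no  ¬u≡iv      = no λ (a , u≡av) →
            ¬u≡iv (from a , λ j → subst (λ b → u j ≡ b · v j) (sym (strictlyInverseˡ a)) (u≡av j))

    proportional-refl : ∀ {v : Vect 𝔽 n} → Proportional 𝔽 v v
    proportional-refl {v} = 1# , λ j → sym (*-identityˡ (v j))

    nonzero-proportional⇒∼ : ∀ {u v} → ¬ IsZero 𝔽 u → Proportional 𝔽 u v → u ∼ v
    nonzero-proportional⇒∼ {u} {v} u≢0 (a , u≡av) = a , a≢0 , u≡av
      where
      a≢0 : a ≢ 0#
      a≢0 refl = u≢0 λ j → trans (u≡av j) (zeroˡ (v j))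

    •-nonzero : ∀ {a v} → a ≢ 0# → ¬ IsZero 𝔽 v → ¬ IsZero 𝔽 (a • v)
    •-nonzero a≢0 v≢0 av≡0 = v≢0 λ j → a·x≡0⇒x≡0 a≢0 (av≡0 j)

    •-injectiveˡ : ∀ {a b v} → ¬ IsZero 𝔽 v → SameVec 𝔽 (a • v) (b • v) → a ≡ b
    •-injectiveˡ v≢0 av≡bv with nonzero-coordinate v≢0
    ... | j , vj≢0 = ·-cancelʳ vj≢0 (av≡bv j)

    •-cancel⇒proportional : ∀ {a b u v} → a ≢ 0# → SameVec 𝔽 (a • u) (b • v) → Proportional 𝔽 u v
    •-cancel⇒proportional {a} {b} {u} {v} a≢0 au≡bv = a⁻¹ · b , λ j → ·-cancelˡ a≢0 (begin
      a · u j               ≡⟨ au≡bv j ⟩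
      b · v j               ≡⟨ cong (_· v j) (*-identityˡ b) ⟨
      1# · b · v j          ≡⟨ cong (λ c → c · b · v j) (proj₂ (inverse a a≢0)) ⟨
      a · a⁻¹ · b · v j     ≡⟨ cong (_· v j) (*-assoc a a⁻¹ b) ⟩
      a · (a⁻¹ · b) · v j   ≡⟨ *-assoc a (a⁻¹ · b) (v j) ⟩
      a · (a⁻¹ · b · v j)   ∎)
      where
      a⁻¹ : F
      a⁻¹ = proj₁ (inverse a a≢0)

    lincomb-∼ : ∀ {xs ys} → Pointwise _∼_ xs ys → ∀ c → ∃ λ c′ →
      SameVec 𝔽 (lincomb 𝔽 xs c) (lincomb 𝔽 ys c′) × ((∀ i → c′ i ≡ 0#) → ∀ i → c i ≡ 0#)
    lincomb-∼ []                           c = (λ ()) , (λ _ → refl) , (λ _ ())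
    lincomb-∼ {x ∷ xs} {y ∷ ys} ((a , a≢0 , x≡ay) ∷ xs∼ys) c with lincomb-∼ xs∼ys (c ∘ suc)
    ... | c′ , same , c′≡0⇒c≡0 = c″ , same′ , c″≡0⇒c≡0
      where
      c″ : Fin (suc (length ys)) → F
      c″ zero    = c zero · a
      c″ (suc i) = c′ i
      same′ : SameVec 𝔽 (lincomb 𝔽 (x ∷ xs) c) (lincomb 𝔽 (y ∷ ys) c″)
      same′ j = +-cong (trans (cong (c zero ·_) (x≡ay j)) (sym (*-assoc (c zero) a _))) (same j)
      c″≡0⇒c≡0 : (∀ i → c″ i ≡ 0#) → ∀ i → c i ≡ 0#
      c″≡0⇒c≡0 c″≡0 zero    = a·x≡0⇒x≡0 a≢0 (trans (*-comm a (c zero)) (c″≡0 zero))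
      c″≡0⇒c≡0 c″≡0 (suc i) = c′≡0⇒c≡0 (c″≡0 ∘ suc) i

    LinIndep-∼ : ∀ {xs ys} → Pointwise _∼_ xs ys → LinIndep 𝔽 ys → LinIndep 𝔽 xs
    LinIndep-∼ xs∼ys ys-indep c xs·c≡0 with lincomb-∼ xs∼ys c
    ... | c′ , same , c′≡0⇒c≡0 = c′≡0⇒c≡0 (ys-indep c′ λ j → trans (sym (same j)) (xs·c≡0 j))

module _ {q : ℕ} (𝔽 : FiniteField q) {n k ℓ : ℕ} where

  KLProperty-⊆ : ∀ {xs ys : List (Vect 𝔽 n)} → xs ⊆ ys → KLProperty 𝔽 k ℓ ys → KLProperty 𝔽 k ℓ xs
  KLProperty-⊆ xs⊆ys kl X X⊆xs |X|≡k = kl X (⊆-trans X⊆xs xs⊆ys) |X|≡k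

  KLProperty-≥ : ∀ {xs X : List (Vect 𝔽 n)} → KLProperty 𝔽 k ℓ xs → X ⊆ xs → k ≤ length X →
                 ∃ λ Y → Y ⊆ X × length Y ≡ ℓ × LinIndep 𝔽 Y
  KLProperty-≥ {X = X} kl X⊆xs k≤|X|
    with kl (take k X) (⊆-trans (take-⊆ k X) X⊆xs) (trans (length-take k X) (ℕ.m≤n⇒m⊓n≡m k≤|X|))
  ... | Y , Y⊆ , |Y|≡ℓ , indep = Y , ⊆-trans Y⊆ (take-⊆ k X) , |Y|≡ℓ , indep

module Projective {d : ℕ} (𝔽 : FiniteField (suc d)) {n : ℕ} where
  open FiniteField 𝔽 using (F; 0#; enumerate) renaming (_*_ to _·_)
  open Inverse enumerate using (to; from; strictlyInverseˡ; strictlyInverseʳ)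
  open FieldProperties 𝔽

  unit : Fin d → F
  unit β = to (punchIn (from 0#) β)

  unit-nonzero : ∀ β → unit β ≢ 0#
  unit-nonzero β β≡0 = punchInᵢ≢i (from 0#) β (trans (sym (strictlyInverseʳ _)) (cong from β≡0))

  unit-injective : ∀ {β γ} → unit β ≡ unit γ → β ≡ γ
  unit-injective {β} {γ} = punchIn-injective (from 0#) β γ ∘ Injection.injective (↔⇒↣ enumerate)

  unit-surjective : ∀ {a} → a ≢ 0# → ∃ λ β → unit β ≡ a
  unit-surjective {a} a≢0 =
    punchOut 0≢a , trans (cong to (punchIn-punchOut 0≢a)) (strictlyInverseˡ a)
    where
    0≢a : from 0# ≢ from a
    0≢a = a≢0 ∘ sym ∘ Injection.injective (↔⇒↣ (↔-sym enumerate))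

  length≤multiples : ∀ {xs ys : List (Vect 𝔽 n)} → AllPairs (λ u v → ¬ SameVec 𝔽 u v) xs →
                     All (λ x → Any (x ∼_) ys) xs → length xs ≤ length ys * d
  length≤multiples {xs} {ys} distinct multiples =
    pigeonhole (length ys * d) Colour clash distinct (All.map colour multiples)
    where
    Colour : Vect 𝔽 n → Fin (length ys * d) → Set
    Colour x c = ∃₂ λ j β → c ≡ combine j β × SameVec 𝔽 x (unit β • lookup ys j)

    colour : ∀ {x} → Any (x ∼_) ys → ∃ (Colour x)
    colour x∼ys with lookup-index x∼ys
    ... | a , a≢0 , x≡ay with unit-surjective a≢0
    ... | β , β≡a = combine (Any.index x∼ys) β , Any.index x∼ys , β , refl ,
                    λ i → trans (x≡ay i) (cong (_· _) (sym β≡a))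

    clash : ∀ {x y c} → Colour x c → Colour y c → ¬ ¬ SameVec 𝔽 x y
    clash (j , β , refl , x≡) (j′ , β′ , c≡ , y≡) x≢y with combine-injective j β j′ β′ c≡
    ... | refl , refl = x≢y λ i → trans (x≡ i) (sym (y≡ i))

  IndSet⇒ProIndSet : ∀ {k ℓ S} → IndSet 𝔽 n k ℓ S →
                     ∃ λ R → ProIndSet 𝔽 n k ℓ R × length S ≤ length R * d
  IndSet⇒ProIndSet {S = S} (nonzero , distinct , kl)
    with representatives proportional? proportional-refl S
  ... | R , R⊆S , apart , cover =
    R , (All-resp-⊆ R⊆S nonzero , apart , KLProperty-⊆ 𝔽 R⊆S kl) ,
    length≤multiples distinct
      (All.zipWith (λ (s≢0 , s∝R) → Any.map (nonzero-proportional⇒∼ s≢0) s∝R) (nonzero , cover))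

  multiplesOf : Vect 𝔽 n → List (Vect 𝔽 n)
  multiplesOf t = tabulate (λ β → unit β • t)

  allMultiples : List (Vect 𝔽 n) → List (Vect 𝔽 n)
  allMultiples = concatMap multiplesOf

  length-allMultiples : ∀ ts → length (allMultiples ts) ≡ length ts * d
  length-allMultiples []       = refl
  length-allMultiples (t ∷ ts) =
    trans (length-++ (multiplesOf t)) (cong₂ _+_ (length-tabulate _) (length-allMultiples ts))

  ∈-multiplesOf⇒∼ : ∀ {x t} → x ∈ multiplesOf t → x ∼ t
  ∈-multiplesOf⇒∼ x∈ with ∈-tabulate⁻ x∈
  ... | β , refl = unit β , unit-nonzero β , λ _ → refl

  allMultiples-nonzero : ∀ {ts} → All (λ t → ¬ IsZero 𝔽 t) ts →
                         All (λ t → ¬ IsZero 𝔽 t) (allMultiples ts)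
  allMultiples-nonzero []           = []
  allMultiples-nonzero (t≢0 ∷ ts≢0) =
    ++⁺ (tabulate⁺ λ β → •-nonzero (unit-nonzero β) t≢0) (allMultiples-nonzero ts≢0)

  allMultiples-distinct : ∀ {ts} → All (λ t → ¬ IsZero 𝔽 t) ts →
                          AllPairs (λ u v → ¬ Proportional 𝔽 u v) ts →
                          AllPairs (λ u v → ¬ SameVec 𝔽 u v) (allMultiples ts)
  allMultiples-distinct []           []              = []
  allMultiples-distinct {t ∷ _} (t≢0 ∷ ts≢0) (t∝̸ts ∷ apart) =
    AllPairs.++⁺ (AllPairs.tabulate⁺ λ β≢γ → β≢γ ∘ unit-injective ∘ •-injectiveˡ t≢0)
                 (allMultiples-distinct ts≢0 apart)
                 (tabulate⁺ λ β → across β t∝̸ts)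
    where
    across : ∀ β {us} → All (λ u → ¬ Proportional 𝔽 t u) us →
             All (λ v → ¬ SameVec 𝔽 (unit β • t) v) (allMultiples us)
    across β []            = []
    across β (t∝̸u ∷ t∝̸us) =
      ++⁺ (tabulate⁺ λ γ → t∝̸u ∘ •-cancel⇒proportional (unit-nonzero β)) (across β t∝̸us)

  allMultiples-KL : ∀ {k ℓ ts} .{{_ : NonZero d}} →
                    KLProperty 𝔽 k ℓ ts → KLProperty 𝔽 (d * k) ℓ (allMultiples ts)
  allMultiples-KL {ts = ts} kl X X⊆ |X|≡dk
    with transversal multiplesOf (λ _ → ℕ.≤-reflexive (length-tabulate _)) ts X⊆
  ... | ts′ , X′ , ts′⊆ts , X′⊆X , X′∈ts′ , |X|≤|ts′|d
    with KLProperty-≥ 𝔽 kl ts′⊆ts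
           (ℕ.*-cancelˡ-≤ d (subst₂ _≤_ |X|≡dk (ℕ.*-comm (length ts′) d) |X|≤|ts′|d))
  ... | Y′ , Y′⊆ts′ , |Y′|≡ℓ , indep
    with Pointwise-⊆ʳ (Pointwise.map ∈-multiplesOf⇒∼ X′∈ts′) Y′⊆ts′
  ... | Y , Y⊆X′ , Y∼Y′ =
    Y , ⊆-trans Y⊆X′ X′⊆X , trans (Pointwise-length Y∼Y′) |Y′|≡ℓ , LinIndep-∼ Y∼Y′ indep

  ProIndSet⇒IndSet : ∀ {k ℓ T} .{{_ : NonZero d}} →
                     ProIndSet 𝔽 n k ℓ T → IndSet 𝔽 n (d * k) ℓ (allMultiples T)
  ProIndSet⇒IndSet (nonzero , apart , kl) =
    allMultiples-nonzero nonzero , allMultiples-distinct nonzero apart , allMultiples-KL kl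

⌈/⌉≤ : ∀ {a b} d .{{_ : NonZero d}} → a ≤ b * d → ⌈ a / d ⌉ ≤ b
⌈/⌉≤ {a} {b} (suc d-1) a≤bd =
  ℕ.≤-pred (m<n*o⇒m/o<n (subst (a + d-1 <_) (ℕ.+-comm (b * suc d-1) (suc d-1))
                                (ℕ.+-mono-≤-< a≤bd (ℕ.n<1+n d-1))))

≤/ : ∀ {b c} d .{{_ : NonZero d}} → b * d ≤ c → b ≤ c / d
≤/ {b} {c} d bd≤c = subst (_≤ c / d) (m*n/n≡m b d) (/-monoˡ-≤ d bd≤c)

proposition2p15 : (q : ℕ) (𝔽 : FiniteField q) .{{_ : NonZero (q ∸ 1)}}
    (n k ℓ : ℕ) → 2 ≤ ℓ → ℓ ≤ k → k ≤ (q ^ n ∸ 1) / (q ∸ 1) → ℓ ≤ n →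
    (a b c : ℕ) →
    IsMaxSize (IndSet 𝔽 n k ℓ) a →
    IsMaxSize (ProIndSet 𝔽 n k ℓ) b →
    IsMaxSize (IndSet 𝔽 n ((q ∸ 1) * k) ℓ) c →
    ⌈ a / (q ∸ 1) ⌉ ≤ b × b ≤ c / (q ∸ 1)
proposition2p15 zero    𝔽 {{()}}
proposition2p15 (suc d) 𝔽 n k ℓ _ _ _ _ _ b c
  ((S , indS , refl) , _) ((T , proT , refl) , b-max) (_ , c-max) = lower , upper
  where
  open Projective 𝔽 {n}

  lower : ⌈ length S / d ⌉ ≤ length T
  lower with IndSet⇒ProIndSet indS
  ... | R , proR , |S|≤|R|d = ⌈/⌉≤ d (ℕ.≤-trans |S|≤|R|d (ℕ.*-monoˡ-≤ d (b-max R proR)))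

  upper : length T ≤ c / d
  upper = ≤/ d (subst (_≤ c) (length-allMultiples T)
                      (c-max (allMultiples T) (ProIndSet⇒IndSet proT)))
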